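{- Let $N$ be a finite set with $|N|\geq 2$ and let $m$ be a standardized supermodular game over $N$. All vertices of the core $C(m)$ are zero-one vectors if and only if $m$ is integer-valued and $m(N)-m(N\setminus\{i\})\leq 1$ for every $i\in N$.
   Context: A game over $N$ is a function $m:2^N\to\mathbb{R}$ with $m(\emptyset)=0$; supermodular means $m(A)+m(B)\leq m(A\cup B)+m(A\cap B)$ for all $A,B\subseteq N$; standardized means $m(S)=0$ for $|S|\leq 1$. The core is $C(m):=\{v\in\mathbb{R}^N:\sum_{i\in N}v_i=m(N),\ \sum_{i\in S}v_i\geq m(S)\ \forall S\subseteq N\}$. -}

module Defs where

open import Level using (Level; 0ℓ)
open import Data.Nat using (ℕ) renaming (zero to nzero; suc to nsuc)
import Data.Nat
open import Data.Integer using (ℤ; +_; -[1+_])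
open import Data.Fin using (Fin; zero; suc)
open import Data.Fin.Subset using (Subset; ⊥; ⊤; _∩_; _∪_; _─_; ⁅_⁆; ∣_∣; inside; outside; Side)
open import Data.Vec using (lookup)
open import Data.Product using (Σ; _×_)
open import Data.Sum using (_⊎_)
open import Relation.Nullary using (¬_)
open import Relation.Binary.PropositionalEquality using (_≡_)
open import Relation.Binary.Structures using (IsTotalOrder)
open import Algebra.Structures using (IsCommutativeRing)

-- An ordered field (with propositional equality).  The real numbers are
-- an instance; the statement below is made for an arbitrary ordered field.
record OrderedField : Set₁ where
  infixl 6 _+_ _-_
  infixl 7 _*_
  infix 4 _≤_ _<_
  field
    Carrier : Set
    _+_ _*_ : Carrier → Carrier → Carrier
    -_      : Carrier → Carrier
    0# 1#   : Carrier
    _≤_     : Carrier → Carrier → Set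
    isCommutativeRing : IsCommutativeRing _≡_ _+_ _*_ -_ 0# 1#
    0≢1     : ¬ (0# ≡ 1#)
    inverse : ∀ x → ¬ (x ≡ 0#) → Σ Carrier (λ y → x * y ≡ 1#)
    isTotalOrder : IsTotalOrder _≡_ _≤_
    +-mono-≤ : ∀ {a b} c → a ≤ b → a + c ≤ b + c
    *-nonneg : ∀ {a b} → 0# ≤ a → 0# ≤ b → 0# ≤ a * b

  _-_ : Carrier → Carrier → Carrier
  x - y = x + (- y)

  _<_ : Carrier → Carrier → Set
  x < y = (x ≤ y) × ¬ (x ≡ y)

  fromℕ : ℕ → Carrier
  fromℕ nzero = 0#
  fromℕ (nsuc k) = 1# + fromℕ k

  fromℤ : ℤ → Carrier
  fromℤ (+ k) = fromℕ k
  fromℤ -[1+ k ] = - (1# + fromℕ k)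

module Games (F : OrderedField) where
  open OrderedField F

  sumAll : ∀ {n} → (Fin n → Carrier) → Carrier
  sumAll {nzero} v = 0#
  sumAll {nsuc n} v = v zero + sumAll (λ i → v (suc i))

  sumOver : ∀ {n} → Subset n → (Fin n → Carrier) → Carrier
  sumOver S v = sumAll (λ i → indicator (lookup S i) (v i))
    where
      indicator : Side → Carrier → Carrier
      indicator outside x = 0#
      indicator inside x = x

  Game : ℕ → Set
  Game n = Subset n → Carrier

  IsGame : ∀ {n} → Game n → Set
  IsGame m = m ⊥ ≡ 0#

  Supermodular : ∀ {n} → Game n → Set
  Supermodular m = ∀ A B → m A + m B ≤ m (A ∪ B) + m (A ∩ B)

  Standardized : ∀ {n} → Game n → Set
  Standardized m = ∀ S → ∣ S ∣ Data.Nat.≤ 1 → m S ≡ 0#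

  InCore : ∀ {n} → Game n → (Fin n → Carrier) → Set
  InCore m v = (sumAll v ≡ m ⊤) × (∀ S → m S ≤ sumOver S v)

  IsVertex : ∀ {n} → Game n → (Fin n → Carrier) → Set
  IsVertex m v = InCore m v ×
    (∀ x y t → InCore m x → InCore m y → 0# < t → t < 1# →
      (∀ i → v i ≡ t * x i + (1# - t) * y i) → ∀ i → x i ≡ v i)

  ZeroOne : ∀ {n} → (Fin n → Carrier) → Set
  ZeroOne v = ∀ i → (v i ≡ 0#) ⊎ (v i ≡ 1#)

  IntegerValued : ∀ {n} → Game n → Set
  IntegerValued m = ∀ S → Σ ℤ (λ k → m S ≡ fromℤ k)

module Submission where

-- Marginal vectors of a supermodular game are vertices of its core, and every coalition S
-- is tight at some marginal vector; so if all vertices are zero-one, m(S) = v(S) is a natural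
-- number and m(N) − m(N∖i) = vᵢ ≤ 1.  Conversely, at a vertex v the tight coalitions form a
-- lattice (by supermodularity) that separates any two players i ≠ j: otherwise moving a small
-- amount of payoff from j to i, and from i to j, gives two core points with midpoint v.  In
-- such a lattice each player i is the only difference between two tight coalitions B and
-- B ∪ {i}, hence vᵢ = m(B ∪ {i}) − m(B) is an integer, and 0 ≤ vᵢ ≤ m(N) − m(N∖i) ≤ 1.

open import Algebra.Bundles using (CommutativeRing)
open import Algebra.Solver.Ring.AlmostCommutativeRing
  using (fromCommutativeRing; _-Raw-AlmostCommutative⟶_)
open import Data.Bool.Properties using (∨-identityʳ)
open import Data.Empty using (⊥-elim)
open import Data.Fin using (Fin; zero; suc; _≟_)
open import Data.Fin.Subset
  using (Subset; _⊆_; ⊥; ⊤; _∩_; _∪_; _─_; ⁅_⁆; _∈_; _∉_; inside; outside)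
open import Data.Fin.Subset.Properties
  using (_∈?_; ∈⊤; ∉⊥; drop-there; x∈⁅x⁆; x∈⁅y⁆⇒x≡y; x≢y⇒x∉⁅y⁆; x∈p∪q⁻; x∈p∪q⁺; x∈p∩q⁺; x∈p∩q⁻;
         x∈p∧x∉q⇒x∈p─q; ⊆-antisym; ∣⁅x⁆∣≡1; ∪-assoc; ∪-comm; ∪-identityˡ; ∪-identityʳ; ∪-zeroˡ;
         ∩-zeroˡ; ∪-distribˡ-∩; p─⊥≡p; ∪-idempotentCommutativeMonoid)
open import Data.Integer as ℤ using (ℤ; -[1+_]; _◃_; sign; ∣_∣; _⊖_)
import Data.Integer.Properties as ℤ
open import Data.List using (List; allFin) renaming ([] to []ₗ; _∷_ to _∷ₗ_)
open import Data.List.Membership.Propositional using () renaming (_∈_ to _∈ₗ_)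
open import Data.List.Membership.Propositional.Properties using (∈-allFin)
open import Data.List.Relation.Unary.Any using () renaming (here to hereₗ; there to thereₗ)
open import Data.Maybe using (Maybe; just; nothing)
open import Data.Nat as ℕ using (ℕ) renaming (zero to nzero; suc to nsuc)
import Data.Nat.Properties as ℕ
open import Data.Product using (Σ; _×_; _,_; proj₁; proj₂)
open import Data.Sign as Sign using (Sign)
open import Data.Sum as Sum using (_⊎_; inj₁; inj₂; [_,_]′)
open import Data.Vec using ([]; _∷_; here; there)
open import Data.Vec.Functional using () renaming (_∷_ to _◂_)
open import Function using (_∘_)
open import Relation.Binary.PropositionalEquality
open import Relation.Binary.Structures using (IsTotalOrder)
open import Relation.Nullary using (yes; no; ¬_)

open import Defs

private
  variable
    n : ℕ

module FieldArithmetic (F : OrderedField) where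
  open OrderedField F

  commutativeRing : CommutativeRing _ _
  commutativeRing = record { isCommutativeRing = isCommutativeRing }

  open CommutativeRing commutativeRing public
    using (+-assoc; +-comm; +-identityˡ; +-identityʳ; -‿inverseʳ; *-assoc; *-comm;
           *-identityˡ; *-identityʳ; distribˡ; distribʳ; zeroˡ; zeroʳ; ring; +-abelianGroup)
  open import Algebra.Properties.Ring ring using (-‿distribʳ-*; -1*x≈-x)
  open import Algebra.Properties.AbelianGroup +-abelianGroup
    using (ε⁻¹≈ε; ⁻¹-∙-comm)
  open import Algebra.Properties.AbelianGroup +-abelianGroup public
    using (⁻¹-involutive) renaming (∙-cancelˡ to +-cancelˡ)
  open ≡-Reasoning

  fromℕ-+ : ∀ a b → fromℕ (a ℕ.+ b) ≡ fromℕ a + fromℕ b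
  fromℕ-+ nzero b = sym (+-identityˡ _)
  fromℕ-+ (nsuc a) b = trans (cong (1# +_) (fromℕ-+ a b)) (sym (+-assoc _ _ _))

  fromℕ-* : ∀ a b → fromℕ (a ℕ.* b) ≡ fromℕ a * fromℕ b
  fromℕ-* nzero b = sym (zeroˡ _)
  fromℕ-* (nsuc a) b = begin
    fromℕ (b ℕ.+ a ℕ.* b)             ≡⟨ fromℕ-+ b (a ℕ.* b) ⟩
    fromℕ b + fromℕ (a ℕ.* b)         ≡⟨ cong₂ _+_ (sym (*-identityˡ _)) (fromℕ-* a b) ⟩
    1# * fromℕ b + fromℕ a * fromℕ b  ≡⟨ sym (distribʳ _ _ _) ⟩
    (1# + fromℕ a) * fromℕ b          ∎

  fromSign : Sign → Carrier
  fromSign Sign.+ = 1#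
  fromSign Sign.- = - 1#

  fromSign-* : ∀ s t → fromSign (s Sign.* t) ≡ fromSign s * fromSign t
  fromSign-* Sign.+ t = sym (*-identityˡ _)
  fromSign-* Sign.- Sign.+ = sym (*-identityʳ _)
  fromSign-* Sign.- Sign.- = begin
    1#             ≡⟨ sym (⁻¹-involutive 1#) ⟩
    - (- 1#)       ≡⟨ cong -_ (sym (-1*x≈-x 1#)) ⟩
    - (- 1# * 1#)  ≡⟨ -‿distribʳ-* _ _ ⟩
    - 1# * - 1#    ∎

  fromℤ-◃ : ∀ s k → fromℤ (s ◃ k) ≡ fromSign s * fromℕ k
  fromℤ-◃ Sign.+ nzero = sym (zeroʳ _)
  fromℤ-◃ Sign.+ (nsuc k) = sym (*-identityˡ _)
  fromℤ-◃ Sign.- nzero = sym (zeroʳ _)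
  fromℤ-◃ Sign.- (nsuc k) = sym (-1*x≈-x _)

  fromℤ-signAbs : ∀ i → fromℤ i ≡ fromSign (sign i) * fromℕ ∣ i ∣
  fromℤ-signAbs i = trans (cong fromℤ (sym (ℤ.◃-inverse i))) (fromℤ-◃ (sign i) ∣ i ∣)

  *-interchange : ∀ a b c d → (a * b) * (c * d) ≡ (a * c) * (b * d)
  *-interchange a b c d = begin
    (a * b) * (c * d)  ≡⟨ *-assoc a b _ ⟩
    a * (b * (c * d))  ≡⟨ cong (a *_) (sym (*-assoc b c d)) ⟩
    a * ((b * c) * d)  ≡⟨ cong (λ z → a * (z * d)) (*-comm b c) ⟩
    a * ((c * b) * d)  ≡⟨ cong (a *_) (*-assoc c b d) ⟩
    a * (c * (b * d))  ≡⟨ sym (*-assoc a c _) ⟩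
    (a * c) * (b * d)  ∎

  fromℤ-* : ∀ i j → fromℤ (i ℤ.* j) ≡ fromℤ i * fromℤ j
  fromℤ-* i j = begin
    fromℤ (sign i Sign.* sign j ◃ ∣ i ∣ ℕ.* ∣ j ∣)
      ≡⟨ fromℤ-◃ (sign i Sign.* sign j) (∣ i ∣ ℕ.* ∣ j ∣) ⟩
    fromSign (sign i Sign.* sign j) * fromℕ (∣ i ∣ ℕ.* ∣ j ∣)
      ≡⟨ cong₂ _*_ (fromSign-* (sign i) (sign j)) (fromℕ-* ∣ i ∣ ∣ j ∣) ⟩
    (fromSign (sign i) * fromSign (sign j)) * (fromℕ ∣ i ∣ * fromℕ ∣ j ∣)
      ≡⟨ *-interchange _ _ _ _ ⟩
    (fromSign (sign i) * fromℕ ∣ i ∣) * (fromSign (sign j) * fromℕ ∣ j ∣)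
      ≡⟨ sym (cong₂ _*_ (fromℤ-signAbs i) (fromℤ-signAbs j)) ⟩
    fromℤ i * fromℤ j ∎

  fromℤ-neg : ∀ i → fromℤ (ℤ.- i) ≡ - fromℤ i
  fromℤ-neg (ℤ.+ nzero) = sym ε⁻¹≈ε
  fromℤ-neg (ℤ.+ nsuc k) = refl
  fromℤ-neg -[1+ k ] = sym (⁻¹-involutive _)

  1+a-1+b : ∀ a b → (1# + a) - (1# + b) ≡ a - b
  1+a-1+b a b = begin
    (1# + a) + - (1# + b)    ≡⟨ cong ((1# + a) +_) (sym (⁻¹-∙-comm 1# b)) ⟩
    (1# + a) + (- 1# + - b)  ≡⟨ cong (_+ (- 1# + - b)) (+-comm 1# a) ⟩
    (a + 1#) + (- 1# + - b)  ≡⟨ +-assoc a 1# _ ⟩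
    a + (1# + (- 1# + - b))  ≡⟨ cong (a +_) (sym (+-assoc 1# (- 1#) (- b))) ⟩
    a + ((1# + - 1#) + - b)  ≡⟨ cong (λ z → a + (z + - b)) (-‿inverseʳ 1#) ⟩
    a + (0# + - b)           ≡⟨ cong (a +_) (+-identityˡ _) ⟩
    a - b                    ∎

  fromℤ-⊖ : ∀ a b → fromℤ (a ⊖ b) ≡ fromℕ a - fromℕ b
  fromℤ-⊖ nzero nzero = sym (-‿inverseʳ 0#)
  fromℤ-⊖ (nsuc a) nzero = begin
    fromℕ (nsuc a)        ≡⟨ sym (+-identityʳ _) ⟩
    fromℕ (nsuc a) + 0#   ≡⟨ cong (fromℕ (nsuc a) +_) (sym ε⁻¹≈ε) ⟩
    fromℕ (nsuc a) - 0#   ∎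
  fromℤ-⊖ nzero (nsuc b) = sym (+-identityˡ _)
  fromℤ-⊖ (nsuc a) (nsuc b) = begin
    fromℤ (nsuc a ⊖ nsuc b)          ≡⟨ cong fromℤ (ℤ.[1+m]⊖[1+n]≡m⊖n a b) ⟩
    fromℤ (a ⊖ b)                    ≡⟨ fromℤ-⊖ a b ⟩
    fromℕ a - fromℕ b                ≡⟨ sym (1+a-1+b _ _) ⟩
    fromℕ (nsuc a) - fromℕ (nsuc b)  ∎

  fromℤ-+ : ∀ i j → fromℤ (i ℤ.+ j) ≡ fromℤ i + fromℤ j
  fromℤ-+ -[1+ a ] -[1+ b ] = begin
    - (1# + fromℕ (nsuc (a ℕ.+ b)))        ≡⟨ cong (λ z → - (1# + z)) (fromℕ-+ (nsuc a) b) ⟩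
    - (1# + ((1# + fromℕ a) + fromℕ b))    ≡⟨ cong (λ z → - (1# + z)) (+-comm (1# + fromℕ a) (fromℕ b)) ⟩
    - (1# + (fromℕ b + (1# + fromℕ a)))    ≡⟨ cong -_ (sym (+-assoc 1# (fromℕ b) _)) ⟩
    - ((1# + fromℕ b) + (1# + fromℕ a))    ≡⟨ sym (⁻¹-∙-comm _ _) ⟩
    - (1# + fromℕ b) + - (1# + fromℕ a)    ≡⟨ +-comm _ _ ⟩
    - (1# + fromℕ a) + - (1# + fromℕ b)    ∎
  fromℤ-+ -[1+ a ] (ℤ.+ b) = trans (fromℤ-⊖ b (nsuc a)) (+-comm _ _)
  fromℤ-+ (ℤ.+ a) -[1+ b ] = fromℤ-⊖ a (nsuc b)
  fromℤ-+ (ℤ.+ a) (ℤ.+ b) = fromℕ-+ a b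

  fromℤ-minus : ∀ i j → fromℤ (i ℤ.- j) ≡ fromℤ i - fromℤ j
  fromℤ-minus i j = trans (fromℤ-+ i (ℤ.- j)) (cong (fromℤ i +_) (fromℤ-neg j))

  -- Equal to fromℤ, but sends ±1 to ±1# on the nose, so that the constants
  -- of solver equations denote 0# and 1# themselves.
  coefficient : ℤ → Carrier
  coefficient (ℤ.+ nzero) = 0#
  coefficient (ℤ.+ nsuc nzero) = 1#
  coefficient (ℤ.+ nsuc (nsuc k)) = fromℕ (nsuc (nsuc k))
  coefficient -[1+ nzero ] = - 1#
  coefficient -[1+ nsuc k ] = - (1# + fromℕ (nsuc k))

  coefficient≡fromℤ : ∀ i → coefficient i ≡ fromℤ i
  coefficient≡fromℤ (ℤ.+ nzero) = refl
  coefficient≡fromℤ (ℤ.+ nsuc nzero) = sym (+-identityʳ 1#)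
  coefficient≡fromℤ (ℤ.+ nsuc (nsuc k)) = refl
  coefficient≡fromℤ -[1+ nzero ] = cong -_ (sym (+-identityʳ 1#))
  coefficient≡fromℤ -[1+ nsuc k ] = refl

  coefficient-homomorphism : ℤ.+-*-rawRing -Raw-AlmostCommutative⟶ fromCommutativeRing commutativeRing
  coefficient-homomorphism = record
    { ⟦_⟧    = coefficient
    ; +-homo = λ i j → via (ℤ._+_ i j) (fromℤ-+ i j) (cong₂ _+_ (coefficient≡fromℤ i) (coefficient≡fromℤ j))
    ; *-homo = λ i j → via (ℤ._*_ i j) (fromℤ-* i j) (cong₂ _*_ (coefficient≡fromℤ i) (coefficient≡fromℤ j))
    ; -‿homo = λ i → via (ℤ.- i) (fromℤ-neg i) (cong -_ (coefficient≡fromℤ i))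
    ; 0-homo = refl
    ; 1-homo = refl
    }
    where
    via : ∀ k {x y} → fromℤ k ≡ x → y ≡ x → coefficient k ≡ y
    via k p q = trans (coefficient≡fromℤ k) (trans p (sym q))

  coefficient-≟ : ∀ i j → Maybe (coefficient i ≡ coefficient j)
  coefficient-≟ i j with i ℤ.≟ j
  ... | yes i≡j = just (cong coefficient i≡j)
  ... | no _ = nothing

  open import Algebra.Solver.Ring ℤ.+-*-rawRing (fromCommutativeRing commutativeRing)
    coefficient-homomorphism coefficient-≟ public

  :0 :1 : ∀ {k} → Polynomial k
  :0 = con (ℤ.+ 0)
  :1 = con (ℤ.+ 1)

  x≡y+[x-y] : ∀ x y → x ≡ y + (x - y)
  x≡y+[x-y] = solve 2 (λ x y → x := y :+ (x :- y)) refl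

  +-interchange : ∀ a b c d → (a + b) + (c + d) ≡ (a + c) + (b + d)
  +-interchange = solve 4 (λ a b c d → (a :+ b) :+ (c :+ d) := (a :+ c) :+ (b :+ d)) refl

module OrderedFieldProperties (F : OrderedField) where
  open OrderedField F
  open FieldArithmetic F
  open IsTotalOrder isTotalOrder public
    using (antisym; total; reflexive) renaming (refl to ≤-refl; trans to ≤-trans)

  +-monoʳ-≤ : ∀ c {a b} → a ≤ b → c + a ≤ c + b
  +-monoʳ-≤ c {a} {b} a≤b = subst₂ _≤_ (+-comm a c) (+-comm b c) (+-mono-≤ c a≤b)

  +-mono-≤₂ : ∀ {a b c d} → a ≤ b → c ≤ d → a + c ≤ b + d
  +-mono-≤₂ {b = b} {c = c} a≤b c≤d = ≤-trans (+-mono-≤ c a≤b) (+-monoʳ-≤ b c≤d)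

  +-cancelʳ-≤ : ∀ c {a b} → a + c ≤ b + c → a ≤ b
  +-cancelʳ-≤ c {a} {b} le = subst₂ _≤_ (x+c-c a) (x+c-c b) (+-mono-≤ (- c) le)
    where
    x+c-c : ∀ x → x + c + - c ≡ x
    x+c-c x = solve 2 (λ x c → x :+ c :+ :- c := x) refl x c

  +-cancelˡ-≤ : ∀ c {a b} → c + a ≤ c + b → a ≤ b
  +-cancelˡ-≤ c {a} {b} le = +-cancelʳ-≤ c (subst₂ _≤_ (+-comm c a) (+-comm c b) le)

  x≤y⇒0≤y-x : ∀ {x y} → x ≤ y → 0# ≤ y - x
  x≤y⇒0≤y-x {x} x≤y = subst₂ _≤_ (solve 1 (λ x → x :+ :- x := :0) refl x) refl (+-mono-≤ (- x) x≤y)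

  0≤y-x⇒x≤y : ∀ {x y} → 0# ≤ y - x → x ≤ y
  0≤y-x⇒x≤y {x} {y} le =
    subst₂ _≤_ (+-identityˡ x) (solve 2 (λ x y → (y :- x) :+ x := y) refl x y) (+-mono-≤ x le)

  x-y≡0⇒x≡y : ∀ {x y} → x - y ≡ 0# → x ≡ y
  x-y≡0⇒x≡y {x} {y} x-y≡0 = begin
    x            ≡⟨ solve 2 (λ x y → x := (x :- y) :+ y) refl x y ⟩
    (x - y) + y  ≡⟨ cong (_+ y) x-y≡0 ⟩
    0# + y       ≡⟨ +-identityˡ y ⟩
    y            ∎
    where open ≡-Reasoning

  0≤1 : 0# ≤ 1#
  0≤1 with total 0# 1#
  ... | inj₁ 0≤1 = 0≤1
  ... | inj₂ 1≤0 = subst₂ _≤_ refl (solve 0 (:- :1 :* :- :1 := :1) refl) (*-nonneg 0≤-1 0≤-1)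
    where
    0≤-1 : 0# ≤ - 1#
    0≤-1 = subst₂ _≤_ (-‿inverseʳ 1#) (+-identityˡ _) (+-mono-≤ (- 1#) 1≤0)

  1≰0 : ¬ (1# ≤ 0#)
  1≰0 1≤0 = 0≢1 (antisym 0≤1 1≤0)

  x≤1+x : ∀ x → x ≤ 1# + x
  x≤1+x x = subst₂ _≤_ (+-identityˡ x) refl (+-mono-≤ x 0≤1)

  *-monoʳ-≤-nonNeg : ∀ {c a b} → 0# ≤ c → a ≤ b → c * a ≤ c * b
  *-monoʳ-≤-nonNeg {c} {a} {b} 0≤c a≤b = 0≤y-x⇒x≤y
    (subst₂ _≤_ refl (solve 3 (λ c a b → c :* (b :- a) := c :* b :- c :* a) refl c a b)
      (*-nonneg 0≤c (x≤y⇒0≤y-x a≤b)))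

  nonNeg+nonNeg≤0⇒≡0 : ∀ {a b} → 0# ≤ a → 0# ≤ b → a + b ≤ 0# → a ≡ 0#
  nonNeg+nonNeg≤0⇒≡0 {a} 0≤a 0≤b a+b≤0 =
    antisym (≤-trans (subst₂ _≤_ (+-identityʳ a) refl (+-monoʳ-≤ a 0≤b)) a+b≤0) 0≤a

  *-cancelˡ-≡0 : ∀ {t a} → t ≢ 0# → t * a ≡ 0# → a ≡ 0#
  *-cancelˡ-≡0 {t} {a} t≢0 ta≡0 with inverse t t≢0
  ... | t⁻¹ , tt⁻¹≡1 = begin
    a               ≡⟨ sym (*-identityˡ a) ⟩
    1# * a          ≡⟨ cong (_* a) (sym tt⁻¹≡1) ⟩
    (t * t⁻¹) * a   ≡⟨ solve 3 (λ t s a → (t :* s) :* a := s :* (t :* a)) refl t t⁻¹ a ⟩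
    t⁻¹ * (t * a)   ≡⟨ cong (t⁻¹ *_) ta≡0 ⟩
    t⁻¹ * 0#        ≡⟨ zeroʳ t⁻¹ ⟩
    0#              ∎
    where open ≡-Reasoning

  convex-combination-at-lower-bound : ∀ {t l a b} → 0# < t → t < 1# → l ≤ a → l ≤ b →
    t * a + (1# - t) * b ≡ l → a ≡ l
  convex-combination-at-lower-bound {t} {l} {a} {b} (0≤t , 0≢t) (t≤1 , _) l≤a l≤b combination≡l =
    x-y≡0⇒x≡y (*-cancelˡ-≡0 (λ t≡0 → 0≢t (sym t≡0)) t[a-l]≡0)
    where
    excess≡0 : t * (a - l) + (1# - t) * (b - l) ≡ 0#
    excess≡0 = begin
      t * (a - l) + (1# - t) * (b - l)  ≡⟨ solve 4 (λ t l a b → t :* (a :- l) :+ (:1 :- t) :* (b :- l)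
                                                   := (t :* a :+ (:1 :- t) :* b) :- l) refl t l a b ⟩
      (t * a + (1# - t) * b) - l        ≡⟨ cong (_- l) combination≡l ⟩
      l - l                             ≡⟨ -‿inverseʳ l ⟩
      0#                                ∎
      where open ≡-Reasoning
    t[a-l]≡0 : t * (a - l) ≡ 0#
    t[a-l]≡0 = nonNeg+nonNeg≤0⇒≡0 (*-nonneg 0≤t (x≤y⇒0≤y-x l≤a))
      (*-nonneg (x≤y⇒0≤y-x t≤1) (x≤y⇒0≤y-x l≤b)) (reflexive excess≡0)

  +-squeezeˡ : ∀ {p q a b} → p ≤ a → q ≤ b → a + b ≤ p + q → a ≡ p
  +-squeezeˡ {p} {q} {a} p≤a q≤b a+b≤p+q =
    antisym (+-cancelʳ-≤ q (≤-trans (+-monoʳ-≤ a q≤b) a+b≤p+q)) p≤a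

  ε≤x-y⇒y≤x-ε : ∀ {ε x y} → ε ≤ x - y → y ≤ x + - ε
  ε≤x-y⇒y≤x-ε {ε} {x} {y} ε≤x-y = 0≤y-x⇒x≤y
    (subst₂ _≤_ refl (solve 3 (λ ε x y → (x :- y) :- ε := (x :+ :- ε) :- y) refl ε x y) (x≤y⇒0≤y-x ε≤x-y))

  1+1≢0 : 1# + 1# ≢ 0#
  1+1≢0 2≡0 = 1≰0 (subst₂ _≤_ refl 2≡0 (x≤1+x 1#))

  ½ : Carrier
  ½ = proj₁ (inverse (1# + 1#) 1+1≢0)

  2*½≡1 : (1# + 1#) * ½ ≡ 1#
  2*½≡1 = proj₂ (inverse (1# + 1#) 1+1≢0)

  ½+½≡1 : ½ + ½ ≡ 1#
  ½+½≡1 = trans (solve 1 (λ h → h :+ h := (:1 :+ :1) :* h) refl ½) 2*½≡1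

  1-½≡½ : 1# - ½ ≡ ½
  1-½≡½ = trans (cong (_- ½) (sym ½+½≡1)) (solve 1 (λ h → (h :+ h) :- h := h) refl ½)

  0<½ : 0# < ½
  0<½ = 0≤½ , 0≢½
    where
    0≤½ : 0# ≤ ½
    0≤½ with total 0# ½
    ... | inj₁ 0≤½ = 0≤½
    ... | inj₂ ½≤0 = ⊥-elim (1≰0 (subst₂ _≤_ 2*½≡1 (zeroʳ _)
                       (*-monoʳ-≤-nonNeg (≤-trans 0≤1 (x≤1+x 1#)) ½≤0)))
    0≢½ : 0# ≢ ½
    0≢½ 0≡½ = 0≢1 (trans (sym (zeroʳ (1# + 1#))) (trans (cong ((1# + 1#) *_) 0≡½) 2*½≡1))

  ½<1 : ½ < 1#
  ½<1 = 0≤y-x⇒x≤y (subst₂ _≤_ refl (sym 1-½≡½) (proj₁ 0<½)) , ½≢1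
    where
    ½≢1 : ½ ≢ 1#
    ½≢1 ½≡1 = 0≢1 (sym (begin
      1#               ≡⟨ solve 0 (:1 := (:1 :+ :1) :- :1) refl ⟩
      (1# + 1#) - 1#   ≡⟨ cong (λ h → (h + h) - 1#) (sym ½≡1) ⟩
      (½ + ½) - 1#     ≡⟨ cong (_- 1#) ½+½≡1 ⟩
      1# - 1#          ≡⟨ -‿inverseʳ 1# ⟩
      0#               ∎))
      where open ≡-Reasoning

  0≤-x⇒x≤0 : ∀ {x} → 0# ≤ - x → x ≤ 0#
  0≤-x⇒x≤0 {x} 0≤-x = subst₂ _≤_ (+-identityˡ x) (solve 1 (λ x → :- x :+ x := :0) refl x) (+-mono-≤ x 0≤-x)

  0≤fromℕ : ∀ k → 0# ≤ fromℕ k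
  0≤fromℕ nzero = ≤-refl
  0≤fromℕ (nsuc k) = ≤-trans (0≤fromℕ k) (x≤1+x (fromℕ k))

  1≤1+fromℕ : ∀ k → 1# ≤ 1# + fromℕ k
  1≤1+fromℕ k = subst₂ _≤_ (+-identityʳ 1#) refl (+-monoʳ-≤ 1# (0≤fromℕ k))

  fromℤ-0≤∧≤1⇒0∨1 : ∀ k → 0# ≤ fromℤ k → fromℤ k ≤ 1# → fromℤ k ≡ 0# ⊎ fromℤ k ≡ 1#
  fromℤ-0≤∧≤1⇒0∨1 (ℤ.+ nzero) _ _ = inj₁ refl
  fromℤ-0≤∧≤1⇒0∨1 (ℤ.+ nsuc nzero) _ _ = inj₂ (+-identityʳ 1#)
  fromℤ-0≤∧≤1⇒0∨1 (ℤ.+ nsuc (nsuc j)) _ 2+j≤1 = ⊥-elim (1≰0 (≤-trans (1≤1+fromℕ j)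
    (+-cancelˡ-≤ 1# (subst₂ _≤_ refl (sym (+-identityʳ 1#)) 2+j≤1))))
  fromℤ-0≤∧≤1⇒0∨1 -[1+ j ] 0≤-[1+j] _ = ⊥-elim (1≰0 (≤-trans (1≤1+fromℕ j) (0≤-x⇒x≤0 0≤-[1+j])))

  argmin : ∀ (f : Subset n → Carrier) → Σ (Subset n) λ S₀ → ∀ S → f S₀ ≤ f S
  argmin {nzero} f = [] , λ { [] → ≤-refl }
  argmin {nsuc n} f with argmin (λ S → f (inside ∷ S)) | argmin (λ S → f (outside ∷ S))
  ... | S₁ , S₁-min | S₂ , S₂-min with total (f (inside ∷ S₁)) (f (outside ∷ S₂))
  ... | inj₁ S₁≤S₂ = inside ∷ S₁ , λ { (inside ∷ S) → S₁-min S ; (outside ∷ S) → ≤-trans S₁≤S₂ (S₂-min S) }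
  ... | inj₂ S₂≤S₁ = outside ∷ S₂ , λ { (inside ∷ S) → ≤-trans S₂≤S₁ (S₁-min S) ; (outside ∷ S) → S₂-min S }

x∈p⇒⁅x⁆∪p≡p : ∀ {x : Fin n} {p} → x ∈ p → ⁅ x ⁆ ∪ p ≡ p
x∈p⇒⁅x⁆∪p≡p {p = inside ∷ p} here = cong (inside ∷_) (∪-identityˡ p)
x∈p⇒⁅x⁆∪p≡p {p = s ∷ p} (there x∈p) = cong (s ∷_) (x∈p⇒⁅x⁆∪p≡p x∈p)

x∉p⇒⁅x⁆∩p≡⊥ : ∀ {x : Fin n} {p} → x ∉ p → ⁅ x ⁆ ∩ p ≡ ⊥
x∉p⇒⁅x⁆∩p≡⊥ {x = zero} {inside ∷ p} x∉p = ⊥-elim (x∉p here)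
x∉p⇒⁅x⁆∩p≡⊥ {x = zero} {outside ∷ p} x∉p = cong (outside ∷_) (∩-zeroˡ p)
x∉p⇒⁅x⁆∩p≡⊥ {x = suc x} {s ∷ p} x∉p = cong (outside ∷_) (x∉p⇒⁅x⁆∩p≡⊥ (x∉p ∘ there))

x∉p─⁅x⁆ : ∀ (p : Subset n) x → x ∉ p ─ ⁅ x ⁆
x∉p─⁅x⁆ (s ∷ p) zero ()
x∉p─⁅x⁆ (s ∷ p) (suc x) (there x∈p─⁅x⁆) = x∉p─⁅x⁆ p x x∈p─⁅x⁆

x∉p⇒p─⁅x⁆≡p : ∀ {x : Fin n} {p} → x ∉ p → p ─ ⁅ x ⁆ ≡ p
x∉p⇒p─⁅x⁆≡p {x = zero} {inside ∷ p} x∉p = ⊥-elim (x∉p here)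
x∉p⇒p─⁅x⁆≡p {x = zero} {outside ∷ p} x∉p = cong (outside ∷_) (p─⊥≡p p)
x∉p⇒p─⁅x⁆≡p {x = suc x} {s ∷ p} x∉p = cong (s ∷_) (x∉p⇒p─⁅x⁆≡p (x∉p ∘ there))

x∈p⇒p─⁅x⁆∪⁅x⁆≡p : ∀ {x : Fin n} {p} → x ∈ p → (p ─ ⁅ x ⁆) ∪ ⁅ x ⁆ ≡ p
x∈p⇒p─⁅x⁆∪⁅x⁆≡p {p = inside ∷ p} here = cong (inside ∷_) (trans (∪-identityʳ _) (p─⊥≡p p))
x∈p⇒p─⁅x⁆∪⁅x⁆≡p {p = inside ∷ p} (there x∈p) = cong (inside ∷_) (x∈p⇒p─⁅x⁆∪⁅x⁆≡p x∈p)
x∈p⇒p─⁅x⁆∪⁅x⁆≡p {p = outside ∷ p} (there x∈p) = cong (outside ∷_) (x∈p⇒p─⁅x⁆∪⁅x⁆≡p x∈p)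

p∪q∪[p∪r]≡p∪q∪r : ∀ (p q r : Subset n) → (p ∪ q) ∪ (p ∪ r) ≡ (p ∪ q) ∪ r
p∪q∪[p∪r]≡p∪q∪r {n} p q r = prove 3 ((x ⊕ y) ⊕ (x ⊕ z)) ((x ⊕ y) ⊕ z) (p ∷ q ∷ r ∷ [])
  where
  open import Algebra.Solver.IdempotentCommutativeMonoid (∪-idempotentCommutativeMonoid n)
  x = var zero
  y = var (suc zero)
  z = var (suc (suc zero))

p∪q∪r≡p∪r∪q : ∀ (p q r : Subset n) → (p ∪ q) ∪ r ≡ (p ∪ r) ∪ q
p∪q∪r≡p∪r∪q {n} p q r = prove 3 ((x ⊕ y) ⊕ z) ((x ⊕ z) ⊕ y) (p ∷ q ∷ r ∷ [])
  where
  open import Algebra.Solver.IdempotentCommutativeMonoid (∪-idempotentCommutativeMonoid n)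
  x = var zero
  y = var (suc zero)
  z = var (suc (suc zero))

x∈r⇒p∪⁅x⁆∪r≡p∪r : ∀ {x : Fin n} p {r} → x ∈ r → (p ∪ ⁅ x ⁆) ∪ r ≡ p ∪ r
x∈r⇒p∪⁅x⁆∪r≡p∪r p x∈r = trans (∪-assoc p _ _) (cong (p ∪_) (x∈p⇒⁅x⁆∪p≡p x∈r))

x∉r⇒[p∪⁅x⁆]∩[p∪r]≡p : ∀ {x : Fin n} p {r} → x ∉ r → (p ∪ ⁅ x ⁆) ∩ (p ∪ r) ≡ p
x∉r⇒[p∪⁅x⁆]∩[p∪r]≡p p {r} x∉r = begin
  (p ∪ ⁅ _ ⁆) ∩ (p ∪ r)  ≡⟨ sym (∪-distribˡ-∩ p _ r) ⟩
  p ∪ (⁅ _ ⁆ ∩ r)        ≡⟨ cong (p ∪_) (x∉p⇒⁅x⁆∩p≡⊥ x∉r) ⟩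
  p ∪ ⊥                  ≡⟨ ∪-identityʳ p ⟩
  p                      ∎
  where open ≡-Reasoning

x∉p∪q : ∀ {x : Fin n} {p q} → x ∉ p → x ∉ q → x ∉ p ∪ q
x∉p∪q {p = p} {q} x∉p x∉q x∈p∪q = [ x∉p , x∉q ]′ (x∈p∪q⁻ p q x∈p∪q)

module Sums (F : OrderedField) where
  open OrderedField F
  open FieldArithmetic F
  open Games F
  open ≡-Reasoning

  sumOver-cong : ∀ (S : Subset n) {f g} → (∀ k → f k ≡ g k) → sumOver S f ≡ sumOver S g
  sumOver-cong [] f≗g = refl
  sumOver-cong (inside ∷ S) f≗g = cong₂ _+_ (f≗g zero) (sumOver-cong S (λ k → f≗g (suc k)))
  sumOver-cong (outside ∷ S) f≗g = cong (0# +_) (sumOver-cong S (λ k → f≗g (suc k)))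

  sumOver-+ : ∀ (S : Subset n) f g → sumOver S (λ k → f k + g k) ≡ sumOver S f + sumOver S g
  sumOver-+ [] f g = sym (+-identityʳ 0#)
  sumOver-+ (inside ∷ S) f g = trans (cong (f zero + g zero +_) (sumOver-+ S _ _)) (+-interchange _ _ _ _)
  sumOver-+ (outside ∷ S) f g = begin
    0# + sumOver S (λ k → f (suc k) + g (suc k))             ≡⟨ cong₂ _+_ (sym (+-identityʳ 0#)) (sumOver-+ S _ _) ⟩
    (0# + 0#) + (sumOver S (f ∘ suc) + sumOver S (g ∘ suc))  ≡⟨ +-interchange _ _ _ _ ⟩
    (0# + sumOver S (f ∘ suc)) + (0# + sumOver S (g ∘ suc))  ∎

  sumOver-* : ∀ (S : Subset n) c f → sumOver S (λ k → c * f k) ≡ c * sumOver S f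
  sumOver-* [] c f = sym (zeroʳ c)
  sumOver-* (inside ∷ S) c f = trans (cong (c * f zero +_) (sumOver-* S c _)) (sym (distribˡ c _ _))
  sumOver-* (outside ∷ S) c f =
    trans (+-identityˡ _) (trans (sumOver-* S c _) (cong (c *_) (sym (+-identityˡ _))))

  sumOver-⊤ : ∀ (v : Fin n → Carrier) → sumOver ⊤ v ≡ sumAll v
  sumOver-⊤ {nzero} v = refl
  sumOver-⊤ {nsuc n} v = cong (v zero +_) (sumOver-⊤ (v ∘ suc))

  sumOver-⊥ : ∀ (v : Fin n → Carrier) → sumOver ⊥ v ≡ 0#
  sumOver-⊥ {nzero} v = refl
  sumOver-⊥ {nsuc n} v = trans (cong (0# +_) (sumOver-⊥ (v ∘ suc))) (+-identityʳ 0#)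

  sumOver-⁅⁆ : ∀ (i : Fin n) v → sumOver ⁅ i ⁆ v ≡ v i
  sumOver-⁅⁆ zero v = trans (cong (v zero +_) (sumOver-⊥ (v ∘ suc))) (+-identityʳ _)
  sumOver-⁅⁆ (suc i) v = trans (+-identityˡ _) (sumOver-⁅⁆ i (v ∘ suc))

  sumOver-∪⁅⁆ : ∀ (P : Subset n) {i} v → i ∉ P → sumOver (P ∪ ⁅ i ⁆) v ≡ sumOver P v + v i
  sumOver-∪⁅⁆ (inside ∷ P) {zero} v i∉P = ⊥-elim (i∉P here)
  sumOver-∪⁅⁆ (outside ∷ P) {zero} v i∉P = begin
    v zero + sumOver (P ∪ ⊥) (v ∘ suc)  ≡⟨ cong (λ X → v zero + sumOver X (v ∘ suc)) (∪-identityʳ P) ⟩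
    v zero + sumOver P (v ∘ suc)        ≡⟨ +-comm _ _ ⟩
    sumOver P (v ∘ suc) + v zero        ≡⟨ cong (_+ v zero) (sym (+-identityˡ _)) ⟩
    0# + sumOver P (v ∘ suc) + v zero   ∎
  sumOver-∪⁅⁆ (inside ∷ P) {suc i} v i∉P =
    trans (cong (v zero +_) (sumOver-∪⁅⁆ P (v ∘ suc) (i∉P ∘ there))) (sym (+-assoc _ _ _))
  sumOver-∪⁅⁆ (outside ∷ P) {suc i} v i∉P =
    trans (cong (0# +_) (sumOver-∪⁅⁆ P (v ∘ suc) (i∉P ∘ there))) (sym (+-assoc _ _ _))

  private
    heads+tails : ∀ {a b c d x y x' y'} → a + b ≡ c + d → x + y ≡ x' + y' →
      (a + x) + (b + y) ≡ (c + x') + (d + y')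
    heads+tails {a} {b} {c} {d} {x} {y} {x'} {y'} heads tails = begin
      (a + x) + (b + y)    ≡⟨ +-interchange a x b y ⟩
      (a + b) + (x + y)    ≡⟨ cong₂ _+_ heads tails ⟩
      (c + d) + (x' + y')  ≡⟨ +-interchange c d x' y' ⟩
      (c + x') + (d + y')  ∎

  sumOver-∪+∩ : ∀ (A B : Subset n) v → sumOver (A ∪ B) v + sumOver (A ∩ B) v ≡ sumOver A v + sumOver B v
  sumOver-∪+∩ [] [] v = refl
  sumOver-∪+∩ (inside ∷ A) (inside ∷ B) v = heads+tails refl (sumOver-∪+∩ A B (v ∘ suc))
  sumOver-∪+∩ (inside ∷ A) (outside ∷ B) v = heads+tails refl (sumOver-∪+∩ A B (v ∘ suc))
  sumOver-∪+∩ (outside ∷ A) (inside ∷ B) v = heads+tails (+-comm _ _) (sumOver-∪+∩ A B (v ∘ suc))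
  sumOver-∪+∩ (outside ∷ A) (outside ∷ B) v = heads+tails refl (sumOver-∪+∩ A B (v ∘ suc))

  sumAll≡sumOver[⊤─⁅i⁆]+vᵢ : ∀ (v : Fin n → Carrier) i → sumAll v ≡ sumOver (⊤ ─ ⁅ i ⁆) v + v i
  sumAll≡sumOver[⊤─⁅i⁆]+vᵢ v i = begin
    sumAll v                          ≡⟨ sym (sumOver-⊤ v) ⟩
    sumOver ⊤ v                       ≡⟨ cong (λ X → sumOver X v) (sym (x∈p⇒p─⁅x⁆∪⁅x⁆≡p (∈⊤ {x = i}))) ⟩
    sumOver ((⊤ ─ ⁅ i ⁆) ∪ ⁅ i ⁆) v   ≡⟨ sumOver-∪⁅⁆ (⊤ ─ ⁅ i ⁆) v (x∉p─⁅x⁆ ⊤ i) ⟩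
    sumOver (⊤ ─ ⁅ i ⁆) v + v i       ∎

  sumOver-zeroOne : ∀ (S : Subset n) v → ZeroOne v → Σ ℕ (λ k → sumOver S v ≡ fromℕ k)
  sumOver-zeroOne [] v zeroOne = 0 , refl
  sumOver-zeroOne (outside ∷ S) v zeroOne with sumOver-zeroOne S (v ∘ suc) (zeroOne ∘ suc)
  ... | k , sum≡k = k , trans (+-identityˡ _) sum≡k
  sumOver-zeroOne (inside ∷ S) v zeroOne with sumOver-zeroOne S (v ∘ suc) (zeroOne ∘ suc) | zeroOne zero
  ... | k , sum≡k | inj₁ v₀≡0 = k , trans (cong₂ _+_ v₀≡0 sum≡k) (+-identityˡ _)
  ... | k , sum≡k | inj₂ v₀≡1 = nsuc k , cong₂ _+_ v₀≡1 sum≡k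

  δ : Fin n → Fin n → Carrier
  δ zero zero = 1#
  δ zero (suc _) = 0#
  δ (suc _) zero = 0#
  δ (suc i) (suc k) = δ i k

  δ-diagonal : ∀ (i : Fin n) → δ i i ≡ 1#
  δ-diagonal zero = refl
  δ-diagonal (suc i) = δ-diagonal i

  δ-offDiagonal : ∀ {i k : Fin n} → k ≢ i → δ i k ≡ 0#
  δ-offDiagonal {i = zero} {zero} k≢i = ⊥-elim (k≢i refl)
  δ-offDiagonal {i = zero} {suc k} k≢i = refl
  δ-offDiagonal {i = suc i} {zero} k≢i = refl
  δ-offDiagonal {i = suc i} {suc k} k≢i = δ-offDiagonal (k≢i ∘ cong suc)

  sumOver-0 : ∀ (S : Subset n) → sumOver S (λ _ → 0#) ≡ 0#
  sumOver-0 S = trans (sumOver-cong S (λ _ → sym (zeroˡ 0#))) (trans (sumOver-* S 0# (λ _ → 0#)) (zeroˡ _))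

  sumOver-δ-∈ : ∀ {S : Subset n} {i} → i ∈ S → sumOver S (δ i) ≡ 1#
  sumOver-δ-∈ {S = inside ∷ S} here = trans (cong (1# +_) (sumOver-0 S)) (+-identityʳ 1#)
  sumOver-δ-∈ {S = inside ∷ S} (there i∈S) = trans (+-identityˡ _) (sumOver-δ-∈ i∈S)
  sumOver-δ-∈ {S = outside ∷ S} (there i∈S) = trans (+-identityˡ _) (sumOver-δ-∈ i∈S)

  sumOver-δ-∉ : ∀ {S : Subset n} {i} → i ∉ S → sumOver S (δ i) ≡ 0#
  sumOver-δ-∉ {S = inside ∷ S} {zero} i∉S = ⊥-elim (i∉S here)
  sumOver-δ-∉ {S = outside ∷ S} {zero} i∉S = trans (+-identityˡ _) (sumOver-0 S)
  sumOver-δ-∉ {S = inside ∷ S} {suc i} i∉S = trans (+-identityˡ _) (sumOver-δ-∉ (i∉S ∘ there))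
  sumOver-δ-∉ {S = outside ∷ S} {suc i} i∉S = trans (+-identityˡ _) (sumOver-δ-∉ (i∉S ∘ there))

module CoreProperties (F : OrderedField) where
  open OrderedField F
  open FieldArithmetic F
  open OrderedFieldProperties F
  open Games F
  open Sums F

  Tight : Game n → (Fin n → Carrier) → Subset n → Set
  Tight m v S = sumOver S v ≡ m S

  tight-⊥ : ∀ {m : Game n} {v} → IsGame m → Tight m v ⊥
  tight-⊥ {v = v} m⊥≡0 = trans (sumOver-⊥ v) (sym m⊥≡0)

  tight-⊤ : ∀ {m : Game n} {v} → InCore m v → Tight m v ⊤
  tight-⊤ {v = v} (efficient , _) = trans (sumOver-⊤ v) efficient

  tight-convex : ∀ {m : Game n} {v x y t} → InCore m x → InCore m y → 0# < t → t < 1# →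
    (∀ k → v k ≡ t * x k + (1# - t) * y k) → ∀ S → Tight m v S → Tight m x S
  tight-convex {m = m} {v} {x} {y} {t} (_ , x≥m) (_ , y≥m) 0<t t<1 v≡tx+[1-t]y S v-tight =
    convex-combination-at-lower-bound 0<t t<1 (x≥m S) (y≥m S) (begin
      t * sumOver S x + (1# - t) * sumOver S y
        ≡⟨ sym (cong₂ _+_ (sumOver-* S t x) (sumOver-* S (1# - t) y)) ⟩
      sumOver S (λ k → t * x k) + sumOver S (λ k → (1# - t) * y k)
        ≡⟨ sym (sumOver-+ S (λ k → t * x k) (λ k → (1# - t) * y k)) ⟩
      sumOver S (λ k → t * x k + (1# - t) * y k)
        ≡⟨ sym (sumOver-cong S v≡tx+[1-t]y) ⟩
      sumOver S v
        ≡⟨ v-tight ⟩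
      m S ∎)
    where open ≡-Reasoning

  module _ {m : Game n} {v} (supermodular : Supermodular m) (v∈C : InCore m v) where

    private
      sums≤values : ∀ A B → Tight m v A → Tight m v B →
        sumOver (A ∪ B) v + sumOver (A ∩ B) v ≤ m (A ∪ B) + m (A ∩ B)
      sums≤values A B A-tight B-tight =
        subst₂ _≤_ (trans (cong₂ _+_ (sym A-tight) (sym B-tight)) (sym (sumOver-∪+∩ A B v))) refl
          (supermodular A B)

    tight-∪ : ∀ {A B} → Tight m v A → Tight m v B → Tight m v (A ∪ B)
    tight-∪ {A} {B} A-tight B-tight =
      +-squeezeˡ (proj₂ v∈C (A ∪ B)) (proj₂ v∈C (A ∩ B)) (sums≤values A B A-tight B-tight)

    tight-∩ : ∀ {A B} → Tight m v A → Tight m v B → Tight m v (A ∩ B)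
    tight-∩ {A} {B} A-tight B-tight =
      +-squeezeˡ (proj₂ v∈C (A ∩ B)) (proj₂ v∈C (A ∪ B))
        (subst₂ _≤_ (+-comm _ _) (+-comm _ _) (sums≤values A B A-tight B-tight))

  core-nonNeg : ∀ {m : Game n} {v} → Standardized m → InCore m v → ∀ k → 0# ≤ v k
  core-nonNeg {v = v} standardized (_ , v≥m) k =
    subst₂ _≤_ (standardized ⁅ k ⁆ (ℕ.≤-reflexive (∣⁅x⁆∣≡1 k))) (sumOver-⁅⁆ k v) (v≥m ⁅ k ⁆)

  core-≤-marginal : ∀ {m : Game n} {v} → InCore m v → ∀ i → v i ≤ m ⊤ - m (⊤ ─ ⁅ i ⁆)
  core-≤-marginal {m = m} {v} (efficient , v≥m) i =
    subst₂ _≤_ (solve 2 (λ a b → (a :+ b) :- b := a) refl (v i) (m S)) (cong (_- m S) sum≡m⊤)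
      (+-mono-≤ (- m S) (+-monoʳ-≤ (v i) (v≥m S)))
    where
    S = ⊤ ─ ⁅ i ⁆
    sum≡m⊤ : v i + sumOver S v ≡ m ⊤
    sum≡m⊤ = trans (+-comm _ _) (trans (sym (sumAll≡sumOver[⊤─⁅i⁆]+vᵢ v i)) efficient)

module MarginalVectors (F : OrderedField) where
  open OrderedField F
  open FieldArithmetic F
  open OrderedFieldProperties F
  open Games F
  open Sums F
  open CoreProperties F

  -- A maximal chain from P to Q along which v pays each added player its marginal
  -- contribution; v is a marginal vector of m when there is such a chain from ⊥ to ⊤.
  data Chain (m : Game n) (v : Fin n → Carrier) : Subset n → Subset n → Set where
    done : ∀ {P} → Chain m v P P
    step : ∀ {P Q} i → i ∉ P → m (P ∪ ⁅ i ⁆) ≡ m P + v i → Chain m v (P ∪ ⁅ i ⁆) Q → Chain m v P Q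

  module _ {m : Game n} {v : Fin n → Carrier} where

    _++_ : ∀ {P Q R} → Chain m v P Q → Chain m v Q R → Chain m v P R
    done ++ chain = chain
    step i i∉P increment chain ++ chain′ = step i i∉P increment (chain ++ chain′)

    step-to : ∀ {P R Q} i → i ∉ P → P ∪ ⁅ i ⁆ ≡ R → m R ≡ m P + v i → Chain m v R Q → Chain m v P Q
    step-to i i∉P refl increment chain = step i i∉P increment chain

    tight-along : ∀ {P Q} → Chain m v P Q → Tight m v P → Tight m v Q
    tight-along done P-tight = P-tight
    tight-along {P} (step i i∉P increment chain) P-tight = tight-along chain (begin
      sumOver (P ∪ ⁅ i ⁆) v  ≡⟨ sumOver-∪⁅⁆ P v i∉P ⟩
      sumOver P v + v i      ≡⟨ cong (_+ v i) P-tight ⟩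
      m P + v i              ≡⟨ sym increment ⟩
      m (P ∪ ⁅ i ⁆)          ∎)
      where open ≡-Reasoning

    marginal-gain-≤ : Supermodular m → ∀ {P} → Chain m v P ⊤ →
      ∀ T → m (P ∪ T) + sumOver P v ≤ m P + sumOver (P ∪ T) v
    marginal-gain-≤ supermodular done T =
      subst (λ X → m X + sumOver ⊤ v ≤ m ⊤ + sumOver X v) (sym (∪-zeroˡ T)) ≤-refl
    marginal-gain-≤ supermodular {P} (step i i∉P increment chain) T with i ∈? T
    ... | yes i∈T = +-cancelʳ-≤ (v i) (subst₂ _≤_ lhs rhs (marginal-gain-≤ supermodular chain T))
      where
      P∪⁅i⁆∪T≡P∪T = x∈r⇒p∪⁅x⁆∪r≡p∪r P i∈T
      lhs : m ((P ∪ ⁅ i ⁆) ∪ T) + sumOver (P ∪ ⁅ i ⁆) v ≡ (m (P ∪ T) + sumOver P v) + v i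
      lhs = trans (cong₂ _+_ (cong m P∪⁅i⁆∪T≡P∪T) (sumOver-∪⁅⁆ P v i∉P)) (sym (+-assoc _ _ _))
      rhs : m (P ∪ ⁅ i ⁆) + sumOver ((P ∪ ⁅ i ⁆) ∪ T) v ≡ (m P + sumOver (P ∪ T) v) + v i
      rhs = trans (cong₂ _+_ increment (cong (λ X → sumOver X v) P∪⁅i⁆∪T≡P∪T))
                  (solve 3 (λ a b c → (a :+ b) :+ c := (a :+ c) :+ b) refl _ _ _)
    ... | no i∉T = +-cancelʳ-≤ K (subst₂ _≤_ lhs rhs (+-mono-≤₂ supermodularity gain))
      where
      P′ = P ∪ ⁅ i ⁆
      K = m P′ + m (P′ ∪ T) + v i
      supermodularity : m P′ + m (P ∪ T) ≤ m (P′ ∪ T) + m P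
      supermodularity = subst₂ _≤_ refl
        (cong₂ _+_ (cong m (p∪q∪[p∪r]≡p∪q∪r P ⁅ i ⁆ T)) (cong m (x∉r⇒[p∪⁅x⁆]∩[p∪r]≡p P i∉T)))
        (supermodular P′ (P ∪ T))
      gain : m (P′ ∪ T) + (sumOver P v + v i) ≤ m P′ + (sumOver (P ∪ T) v + v i)
      gain = subst₂ _≤_ (cong (m (P′ ∪ T) +_) (sumOver-∪⁅⁆ P v i∉P))
        (cong (m P′ +_) (trans (cong (λ X → sumOver X v) (p∪q∪r≡p∪r∪q P ⁅ i ⁆ T))
                               (sumOver-∪⁅⁆ (P ∪ T) v (x∉p∪q i∉P i∉T))))
        (marginal-gain-≤ supermodular chain T)
      lhs : (m P′ + m (P ∪ T)) + (m (P′ ∪ T) + (sumOver P v + v i)) ≡ (m (P ∪ T) + sumOver P v) + K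
      lhs = solve 5 (λ a b c s w → (a :+ b) :+ (c :+ (s :+ w)) := (b :+ s) :+ (a :+ c :+ w))
              refl (m P′) (m (P ∪ T)) (m (P′ ∪ T)) (sumOver P v) (v i)
      rhs : (m (P′ ∪ T) + m P) + (m P′ + (sumOver (P ∪ T) v + v i)) ≡ (m P + sumOver (P ∪ T) v) + K
      rhs = solve 5 (λ c d a s w → (c :+ d) :+ (a :+ (s :+ w)) := (d :+ s) :+ (a :+ c :+ w))
              refl (m (P′ ∪ T)) (m P) (m P′) (sumOver (P ∪ T) v) (v i)

    agrees-along : ∀ {x P Q} → Chain m v P Q → Tight m v P → (∀ S → Tight m v S → Tight m x S) →
      (∀ k → k ∈ P → x k ≡ v k) → ∀ k → k ∈ Q → x k ≡ v k
    agrees-along done _ _ x≡v = x≡v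
    agrees-along {x} {P} (step i i∉P increment chain) P-tight tight⇒tight x≡v =
      agrees-along chain (tight-along (step i i∉P increment done) P-tight) tight⇒tight x≡v′
      where
      xᵢ≡vᵢ : x i ≡ v i
      xᵢ≡vᵢ = +-cancelˡ (m P) (x i) (v i) (begin
        m P + x i                ≡⟨ cong (_+ x i) (sym (tight⇒tight P P-tight)) ⟩
        sumOver P x + x i        ≡⟨ sym (sumOver-∪⁅⁆ P x i∉P) ⟩
        sumOver (P ∪ ⁅ i ⁆) x    ≡⟨ tight⇒tight _ (tight-along (step i i∉P increment done) P-tight) ⟩
        m (P ∪ ⁅ i ⁆)            ≡⟨ increment ⟩
        m P + v i                ∎)
        where open ≡-Reasoning
      x≡v′ : ∀ k → k ∈ P ∪ ⁅ i ⁆ → x k ≡ v k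
      x≡v′ k k∈P∪⁅i⁆ with x∈p∪q⁻ P ⁅ i ⁆ k∈P∪⁅i⁆
      ... | inj₁ k∈P = x≡v k k∈P
      ... | inj₂ k∈⁅i⁆ rewrite x∈⁅y⁆⇒x≡y i k∈⁅i⁆ = xᵢ≡vᵢ

    marginal-vector-isVertex : IsGame m → Supermodular m → Chain m v ⊥ ⊤ → IsVertex m v
    marginal-vector-isVertex m⊥≡0 supermodular chain = v∈C , extreme
      where
      v∈C : InCore m v
      v∈C = trans (sym (sumOver-⊤ v)) (tight-along chain (tight-⊥ {m = m} {v} m⊥≡0))
          , λ S → subst₂ _≤_ (trans (cong₂ _+_ (cong m (∪-identityˡ S)) (sumOver-⊥ v)) (+-identityʳ _))
                             (trans (cong₂ _+_ m⊥≡0 (cong (λ X → sumOver X v) (∪-identityˡ S))) (+-identityˡ _))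
                             (marginal-gain-≤ supermodular chain S)
      extreme : ∀ x y t → InCore m x → InCore m y → 0# < t → t < 1# →
        (∀ i → v i ≡ t * x i + (1# - t) * y i) → ∀ i → x i ≡ v i
      extreme x y t x∈C y∈C 0<t t<1 v≡tx+[1-t]y k =
        agrees-along chain (tight-⊥ {m = m} {v} m⊥≡0) (tight-convex x∈C y∈C 0<t t<1 v≡tx+[1-t]y)
          (λ k k∈⊥ → ⊥-elim (∉⊥ k∈⊥)) k ∈⊤

  lift : ∀ {m : Game (nsuc n)} {v} b a {P Q} →
    Chain (λ X → m (b ∷ X)) v P Q → Chain m (a ◂ v) (b ∷ P) (b ∷ Q)
  lift b a done = done
  lift b a {P} (step i i∉P increment chain) =
    step-to (suc i) (i∉P ∘ drop-there) (cong (_∷ (P ∪ ⁅ i ⁆)) (∨-identityʳ b)) increment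
      (lift b a chain)

  chain-through : ∀ (m : Game n) S → Σ (Fin n → Carrier) λ v → Chain m v ⊥ S × Chain m v S ⊤
  chain-through {nzero} m [] = (λ ()) , done , done
  chain-through {nsuc n} m (inside ∷ S) with chain-through (λ X → m (inside ∷ X)) S
  ... | v , ⊥→S , S→⊤ =
    a ◂ v , step-to zero (λ ()) (cong (inside ∷_) (∪-identityʳ ⊥)) (x≡y+[x-y] _ _) (lift inside a ⊥→S)
          , lift inside a S→⊤
    where a = m (inside ∷ ⊥) - m ⊥
  chain-through {nsuc n} m (outside ∷ S) with chain-through (λ X → m (outside ∷ X)) S
  ... | v , ⊥→S , S→⊤ =
    a ◂ v , lift outside a ⊥→S
          , lift outside a S→⊤ ++ step-to zero (λ ()) (cong (inside ∷_) (∪-identityʳ ⊤)) (x≡y+[x-y] _ _) done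
    where a = m ⊤ - m (outside ∷ ⊤)

  vertex-tight-at : ∀ {m : Game n} → IsGame m → Supermodular m → ∀ S →
    Σ (Fin n → Carrier) λ v → IsVertex m v × Tight m v S
  vertex-tight-at {m = m} m⊥≡0 supermodular S with chain-through m S
  ... | v , ⊥→S , S→⊤ =
    v , marginal-vector-isVertex m⊥≡0 supermodular (⊥→S ++ S→⊤) , tight-along ⊥→S (tight-⊥ {m = m} {v} m⊥≡0)

  module _ {m : Game n} (m⊥≡0 : IsGame m) (supermodular : Supermodular m)
           (zeroOne : ∀ v → IsVertex m v → ZeroOne v) where

    zeroOne-vertices⇒integerValued : IntegerValued m
    zeroOne-vertices⇒integerValued S with vertex-tight-at m⊥≡0 supermodular S
    ... | v , v-vertex , S-tight with sumOver-zeroOne S v (zeroOne v v-vertex)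
    ... | k , sum≡k = ℤ.+ k , trans (sym S-tight) sum≡k

    zeroOne-vertices⇒marginal≤1 : ∀ i → m ⊤ - m (⊤ ─ ⁅ i ⁆) ≤ 1#
    zeroOne-vertices⇒marginal≤1 i with vertex-tight-at m⊥≡0 supermodular (⊤ ─ ⁅ i ⁆)
    ... | v , v-vertex , S-tight = subst₂ _≤_ (sym marginal≡vᵢ) refl (zeroOne⇒≤1 (zeroOne v v-vertex i))
      where
      S = ⊤ ─ ⁅ i ⁆
      marginal≡vᵢ : m ⊤ - m S ≡ v i
      marginal≡vᵢ = begin
        m ⊤ - m S                          ≡⟨ cong₂ _-_ (sym (proj₁ (proj₁ v-vertex))) (sym S-tight) ⟩
        sumAll v - sumOver S v             ≡⟨ cong (_- sumOver S v) (sumAll≡sumOver[⊤─⁅i⁆]+vᵢ v i) ⟩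
        (sumOver S v + v i) - sumOver S v  ≡⟨ solve 2 (λ a b → (a :+ b) :- a := b) refl (sumOver S v) (v i) ⟩
        v i                                ∎
        where open ≡-Reasoning
      zeroOne⇒≤1 : v i ≡ 0# ⊎ v i ≡ 1# → v i ≤ 1#
      zeroOne⇒≤1 (inj₁ vᵢ≡0) = subst₂ _≤_ (sym vᵢ≡0) refl 0≤1
      zeroOne⇒≤1 (inj₂ vᵢ≡1) = subst₂ _≤_ (sym vᵢ≡1) refl ≤-refl

module SeparatingLattice {n} (L : Subset n → Set)
  (L-⊤ : L ⊤) (L-⊥ : L ⊥)
  (L-∪ : ∀ {A B} → L A → L B → L (A ∪ B)) (L-∩ : ∀ {A B} → L A → L B → L (A ∩ B))
  (separating : ∀ {i j} → i ≢ j →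
     Σ (Subset n) (λ S → L S × i ∈ S × j ∉ S) ⊎ Σ (Subset n) (λ S → L S × j ∈ S × i ∉ S))
  where

  record Bracket (i : Fin n) (ks : List (Fin n)) : Set where
    field
      upper lower : Subset n
      upper∈L : L upper
      lower∈L : L lower
      i∈upper : i ∈ upper
      i∉lower : i ∉ lower
      lower⊆upper : lower ⊆ upper
      squeezed : ∀ {k} → k ∈ₗ ks → k ≢ i → k ∈ upper → k ∈ lower

  bracket : ∀ i ks → Bracket i ks
  bracket i []ₗ = record
    { upper = ⊤ ; lower = ⊥ ; upper∈L = L-⊤ ; lower∈L = L-⊥ ; i∈upper = ∈⊤ ; i∉lower = ∉⊥
    ; lower⊆upper = λ k∈⊥ → ⊥-elim (∉⊥ k∈⊥) ; squeezed = λ () }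
  bracket i (j ∷ₗ ks) with bracket i ks | j ≟ i
  ... | b | yes refl = record
    { upper = upper ; lower = lower ; upper∈L = upper∈L ; lower∈L = lower∈L ; i∈upper = i∈upper
    ; i∉lower = i∉lower ; lower⊆upper = lower⊆upper ; squeezed = squeezed′ }
    where
    open Bracket b
    squeezed′ : ∀ {k} → k ∈ₗ j ∷ₗ ks → k ≢ j → k ∈ upper → k ∈ lower
    squeezed′ (hereₗ refl) k≢j = ⊥-elim (k≢j refl)
    squeezed′ (thereₗ k∈ks) = squeezed k∈ks
  ... | b | no j≢i with separating {i} {j} (λ i≡j → j≢i (sym i≡j))
  ...   | inj₁ (S , S∈L , i∈S , j∉S) = record
    { upper = upper ∩ S ; lower = lower ∩ S
    ; upper∈L = L-∩ upper∈L S∈L ; lower∈L = L-∩ lower∈L S∈L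
    ; i∈upper = x∈p∩q⁺ (i∈upper , i∈S)
    ; i∉lower = λ i∈lower∩S → i∉lower (proj₁ (x∈p∩q⁻ lower S i∈lower∩S))
    ; lower⊆upper = λ k∈lower∩S → let k∈lower , k∈S = x∈p∩q⁻ lower S k∈lower∩S in
                                  x∈p∩q⁺ (lower⊆upper k∈lower , k∈S)
    ; squeezed = squeezed′ }
    where
    open Bracket b
    squeezed′ : ∀ {k} → k ∈ₗ j ∷ₗ ks → k ≢ i → k ∈ upper ∩ S → k ∈ lower ∩ S
    squeezed′ (hereₗ refl) _ k∈upper∩S = ⊥-elim (j∉S (proj₂ (x∈p∩q⁻ upper S k∈upper∩S)))
    squeezed′ (thereₗ k∈ks) k≢i k∈upper∩S = let k∈upper , k∈S = x∈p∩q⁻ upper S k∈upper∩S in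
                                              x∈p∩q⁺ (squeezed k∈ks k≢i k∈upper , k∈S)
  ...   | inj₂ (S , S∈L , j∈S , i∉S) = record
    { upper = upper ; lower = lower ∪ (upper ∩ S)
    ; upper∈L = upper∈L ; lower∈L = L-∪ lower∈L (L-∩ upper∈L S∈L)
    ; i∈upper = i∈upper
    ; i∉lower = λ i∈ → [ i∉lower , (λ i∈upper∩S → i∉S (proj₂ (x∈p∩q⁻ upper S i∈upper∩S))) ]′
                         (x∈p∪q⁻ lower _ i∈)
    ; lower⊆upper = λ k∈ → [ lower⊆upper , (λ k∈upper∩S → proj₁ (x∈p∩q⁻ upper S k∈upper∩S)) ]′
                             (x∈p∪q⁻ lower _ k∈)
    ; squeezed = squeezed′ }
    where
    open Bracket b
    squeezed′ : ∀ {k} → k ∈ₗ j ∷ₗ ks → k ≢ i → k ∈ upper → k ∈ lower ∪ (upper ∩ S)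
    squeezed′ (hereₗ refl) _ k∈upper = x∈p∪q⁺ (inj₂ (x∈p∩q⁺ (k∈upper , j∈S)))
    squeezed′ (thereₗ k∈ks) k≢i k∈upper = x∈p∪q⁺ (inj₁ (squeezed k∈ks k≢i k∈upper))

  covering-step : ∀ i → Σ (Subset n) λ B → L B × i ∉ B × L (B ∪ ⁅ i ⁆)
  covering-step i = lower , lower∈L , i∉lower , subst L upper≡lower∪⁅i⁆ upper∈L
    where
    open Bracket (bracket i (allFin n))
    upper≡lower∪⁅i⁆ : upper ≡ lower ∪ ⁅ i ⁆
    upper≡lower∪⁅i⁆ = ⊆-antisym
      (λ {k} k∈upper → x∈p∪q⁺ (case-i k k∈upper))
      (λ k∈ → [ lower⊆upper , (λ k∈⁅i⁆ → subst (_∈ upper) (sym (x∈⁅y⁆⇒x≡y i k∈⁅i⁆)) i∈upper) ]′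
                (x∈p∪q⁻ lower ⁅ i ⁆ k∈))
      where
      case-i : ∀ k → k ∈ upper → k ∈ lower ⊎ k ∈ ⁅ i ⁆
      case-i k k∈upper with k ≟ i
      ... | yes refl = inj₂ (x∈⁅x⁆ k)
      ... | no k≢i = inj₁ (squeezed (∈-allFin k) k≢i k∈upper)

module ZeroOneVertices (F : OrderedField) where
  open OrderedField F
  open FieldArithmetic F
  open OrderedFieldProperties F
  open Games F
  open Sums F
  open CoreProperties F

  module _ {m : Game n} {v} (v-vertex : IsVertex m v) where

    private
      v∈C = proj₁ v-vertex

    slack : Subset n → Carrier
    slack S = sumOver S v - m S

    shift : Fin n → Fin n → Carrier → Fin n → Carrier
    shift i j d k = v k + (d * δ i k + (- d) * δ j k)

    module _ {i j : Fin n} where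

      sumOver-shift : ∀ d T →
        sumOver T (shift i j d) ≡ sumOver T v + (d * sumOver T (δ i) + (- d) * sumOver T (δ j))
      sumOver-shift d T = begin
        sumOver T (shift i j d)
          ≡⟨ sumOver-+ T v _ ⟩
        sumOver T v + sumOver T (λ k → d * δ i k + (- d) * δ j k)
          ≡⟨ cong (sumOver T v +_) (trans (sumOver-+ T _ _)
               (cong₂ _+_ (sumOver-* T d (δ i)) (sumOver-* T (- d) (δ j)))) ⟩
        sumOver T v + (d * sumOver T (δ i) + (- d) * sumOver T (δ j)) ∎
        where open ≡-Reasoning

      shift-∈C : ∀ d → (∀ T → i ∈ T → j ∉ T → m T ≤ sumOver T v + d) →
        (∀ T → j ∈ T → i ∉ T → m T ≤ sumOver T v + (- d)) → InCore m (shift i j d)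
      shift-∈C d ij-bound ji-bound = efficient , λ T → subst₂ _≤_ refl (sym (sumOver-shift d T)) (bound T)
        where
        open ≡-Reasoning
        unchanged : ∀ T → sumOver T v ≡ sumOver T v + (d * 1# + (- d) * 1#) ×
                          sumOver T v ≡ sumOver T v + (d * 0# + (- d) * 0#)
        unchanged T = solve 2 (λ s d → s := s :+ (d :* :1 :+ (:- d) :* :1)) refl (sumOver T v) d
                    , solve 2 (λ s d → s := s :+ (d :* :0 :+ (:- d) :* :0)) refl (sumOver T v) d
        bound : ∀ T → m T ≤ sumOver T v + (d * sumOver T (δ i) + (- d) * sumOver T (δ j))
        bound T with i ∈? T | j ∈? T
        ... | yes i∈T | yes j∈T rewrite sumOver-δ-∈ i∈T | sumOver-δ-∈ j∈T =
          subst₂ _≤_ refl (proj₁ (unchanged T)) (proj₂ v∈C T)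
        ... | no i∉T | no j∉T rewrite sumOver-δ-∉ i∉T | sumOver-δ-∉ j∉T =
          subst₂ _≤_ refl (proj₂ (unchanged T)) (proj₂ v∈C T)
        ... | yes i∈T | no j∉T rewrite sumOver-δ-∈ i∈T | sumOver-δ-∉ j∉T =
          subst₂ _≤_ refl (solve 2 (λ s d → s :+ d := s :+ (d :* :1 :+ (:- d) :* :0)) refl (sumOver T v) d)
            (ij-bound T i∈T j∉T)
        ... | no i∉T | yes j∈T rewrite sumOver-δ-∉ i∉T | sumOver-δ-∈ j∈T =
          subst₂ _≤_ refl (solve 2 (λ s d → s :+ :- d := s :+ (d :* :0 :+ (:- d) :* :1)) refl (sumOver T v) d)
            (ji-bound T j∈T i∉T)
        efficient : sumAll (shift i j d) ≡ m ⊤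
        efficient = begin
          sumAll (shift i j d)                  ≡⟨ sym (sumOver-⊤ (shift i j d)) ⟩
          sumOver ⊤ (shift i j d)               ≡⟨ sumOver-shift d ⊤ ⟩
          sumOver ⊤ v + (d * sumOver ⊤ (δ i) + (- d) * sumOver ⊤ (δ j))
            ≡⟨ cong₂ (λ a b → sumOver ⊤ v + (d * a + (- d) * b))
                     (sumOver-δ-∈ {i = i} ∈⊤) (sumOver-δ-∈ {i = j} ∈⊤) ⟩
          sumOver ⊤ v + (d * 1# + (- d) * 1#)   ≡⟨ sym (proj₁ (unchanged ⊤)) ⟩
          sumOver ⊤ v                           ≡⟨ tight-⊤ v∈C ⟩
          m ⊤                                   ∎

      v≡midpoint-of-shifts : ∀ ε k → v k ≡ ½ * shift i j ε k + (1# - ½) * shift i j (- ε) k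
      v≡midpoint-of-shifts ε k = sym (begin
        ½ * shift i j ε k + (1# - ½) * shift i j (- ε) k
          ≡⟨ cong (λ w → ½ * shift i j ε k + w * shift i j (- ε) k) 1-½≡½ ⟩
        ½ * shift i j ε k + ½ * shift i j (- ε) k
          ≡⟨ solve 5 (λ h v ε p q → h :* (v :+ (ε :* p :+ (:- ε) :* q))
                                     :+ h :* (v :+ ((:- ε) :* p :+ (:- (:- ε)) :* q)) := (h :+ h) :* v)
                     refl ½ (v k) ε (δ i k) (δ j k) ⟩
        (½ + ½) * v k  ≡⟨ cong (_* v k) ½+½≡1 ⟩
        1# * v k       ≡⟨ *-identityˡ _ ⟩
        v k            ∎)
        where open ≡-Reasoning

      -- Both shifts by ±ε stay in the core, and v is their midpoint.
      separating-slack-bound≡0 : i ≢ j → ∀ {ε} → 0# ≤ ε →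
        (∀ T → i ∈ T → j ∉ T → ε ≤ slack T) → (∀ T → j ∈ T → i ∉ T → ε ≤ slack T) → ε ≡ 0#
      separating-slack-bound≡0 i≢j {ε} 0≤ε ε≤slack-ij ε≤slack-ji = begin
        ε                                    ≡⟨ solve 2 (λ w ε → ε := (w :+ (ε :* :1 :+ (:- ε) :* :0)) :- w)
                                                        refl (v i) ε ⟩
        (v i + (ε * 1# + (- ε) * 0#)) - v i  ≡⟨ cong₂ (λ a b → (v i + (ε * a + (- ε) * b)) - v i)
                                                  (sym (δ-diagonal i)) (sym (δ-offDiagonal {i = j} i≢j)) ⟩
        shift i j ε i - v i                  ≡⟨ cong (_- v i) up≡v ⟩
        v i - v i                            ≡⟨ -‿inverseʳ _ ⟩
        0#                                   ∎
        where
        open ≡-Reasoning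
        m≤v+ε : ∀ T → m T ≤ sumOver T v + ε
        m≤v+ε T = ≤-trans (proj₂ v∈C T) (subst₂ _≤_ (+-identityʳ _) refl (+-monoʳ-≤ _ 0≤ε))
        up∈C : InCore m (shift i j ε)
        up∈C = shift-∈C ε (λ T _ _ → m≤v+ε T) (λ T j∈T i∉T → ε≤x-y⇒y≤x-ε (ε≤slack-ji T j∈T i∉T))
        down∈C : InCore m (shift i j (- ε))
        down∈C = shift-∈C (- ε) (λ T i∈T j∉T → ε≤x-y⇒y≤x-ε (ε≤slack-ij T i∈T j∉T))
          (λ T _ _ → subst₂ _≤_ refl (cong (sumOver T v +_) (sym (⁻¹-involutive ε))) (m≤v+ε T))
        up≡v : shift i j ε i ≡ v i
        up≡v = proj₂ v-vertex (shift i j ε) (shift i j (- ε)) ½ up∈C down∈C 0<½ ½<1 (v≡midpoint-of-shifts ε) i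

    force : Fin n → Fin n → Subset n → Subset n
    force i j S = (S ∪ ⁅ i ⁆) ─ ⁅ j ⁆

    minimal-separating-slack : ∀ {i j} → i ≢ j →
      Σ (Subset n) λ S₀ → i ∈ S₀ × j ∉ S₀ × (∀ T → i ∈ T → j ∉ T → slack S₀ ≤ slack T)
    minimal-separating-slack {i} {j} i≢j with argmin (slack ∘ force i j)
    ... | S₀ , S₀-min = force i j S₀ , i∈force , x∉p─⁅x⁆ _ j , λ T i∈T j∉T →
      subst (λ X → slack (force i j S₀) ≤ slack X) (force-identity i∈T j∉T) (S₀-min T)
      where
      i∈force : i ∈ force i j S₀
      i∈force = x∈p∧x∉q⇒x∈p─q (x∈p∪q⁺ (inj₂ (x∈⁅x⁆ i))) (x≢y⇒x∉⁅y⁆ i≢j)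
      force-identity : ∀ {T} → i ∈ T → j ∉ T → force i j T ≡ T
      force-identity {T} i∈T j∉T =
        trans (cong (_─ ⁅ j ⁆) (trans (∪-comm T ⁅ i ⁆) (x∈p⇒⁅x⁆∪p≡p i∈T))) (x∉p⇒p─⁅x⁆≡p j∉T)

    tight-if-separating-slack-minimal : ∀ {i j} → i ≢ j → ∀ S → (∀ T → i ∈ T → j ∉ T → slack S ≤ slack T) →
      (∀ T → j ∈ T → i ∉ T → slack S ≤ slack T) → Tight m v S
    tight-if-separating-slack-minimal i≢j S ij-min ji-min =
      x-y≡0⇒x≡y (separating-slack-bound≡0 i≢j (x≤y⇒0≤y-x (proj₂ v∈C S)) ij-min ji-min)

    tight-separating : ∀ {i j} → i ≢ j →
      Σ (Subset n) (λ S → Tight m v S × i ∈ S × j ∉ S) ⊎ Σ (Subset n) (λ S → Tight m v S × j ∈ S × i ∉ S)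
    tight-separating {i} {j} i≢j
      with minimal-separating-slack i≢j | minimal-separating-slack (i≢j ∘ sym)
    ... | A , i∈A , j∉A , A-min | B , j∈B , i∉B , B-min with total (slack A) (slack B)
    ... | inj₁ A≤B = inj₁ (A , A-tight , i∈A , j∉A)
      where
      A-tight = tight-if-separating-slack-minimal i≢j A A-min (λ T j∈T i∉T → ≤-trans A≤B (B-min T j∈T i∉T))
    ... | inj₂ B≤A = inj₂ (B , B-tight , j∈B , i∉B)
      where
      B-tight = tight-if-separating-slack-minimal i≢j B (λ T i∈T j∉T → ≤-trans B≤A (A-min T i∈T j∉T)) B-min

  module _ {m : Game n} (m⊥≡0 : IsGame m) (standardized : Standardized m) (supermodular : Supermodular m)
           (integerValued : IntegerValued m) (marginal≤1 : ∀ i → m ⊤ - m (⊤ ─ ⁅ i ⁆) ≤ 1#) where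

    vertex-zeroOne : ∀ {v} → IsVertex m v → ZeroOne v
    vertex-zeroOne {v} v-vertex i with covering-step i
      where
      open SeparatingLattice (Tight m v) (tight-⊤ (proj₁ v-vertex)) (tight-⊥ {m = m} {v} m⊥≡0)
        (tight-∪ supermodular (proj₁ v-vertex)) (tight-∩ supermodular (proj₁ v-vertex))
        (tight-separating v-vertex)
    ... | B , B-tight , i∉B , B∪⁅i⁆-tight with integerValued (B ∪ ⁅ i ⁆) | integerValued B
    ... | a , m[B∪⁅i⁆]≡a | b , m[B]≡b =
      Sum.map (trans vᵢ≡a-b) (trans vᵢ≡a-b) (fromℤ-0≤∧≤1⇒0∨1 (a ℤ.- b)
        (subst₂ _≤_ refl vᵢ≡a-b (core-nonNeg standardized (proj₁ v-vertex) i))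
        (subst₂ _≤_ vᵢ≡a-b refl (≤-trans (core-≤-marginal (proj₁ v-vertex) i) (marginal≤1 i))))
      where
      open ≡-Reasoning
      vᵢ≡a-b : v i ≡ fromℤ (a ℤ.- b)
      vᵢ≡a-b = begin
        v i                                  ≡⟨ solve 2 (λ s w → w := (s :+ w) :- s) refl (sumOver B v) (v i) ⟩
        (sumOver B v + v i) - sumOver B v    ≡⟨ cong (_- sumOver B v) (sym (sumOver-∪⁅⁆ B v i∉B)) ⟩
        sumOver (B ∪ ⁅ i ⁆) v - sumOver B v  ≡⟨ cong₂ _-_ B∪⁅i⁆-tight B-tight ⟩
        m (B ∪ ⁅ i ⁆) - m B                  ≡⟨ cong₂ _-_ m[B∪⁅i⁆]≡a m[B]≡b ⟩
        fromℤ a - fromℤ b                    ≡⟨ sym (fromℤ-minus a b) ⟩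
        fromℤ (a ℤ.- b)                      ∎

open import Data.Nat using (_≤_)
open import Function.Bundles using (_⇔_; mk⇔)
open OrderedField using (1#; _-_)
open Games

corollary4 : (F : OrderedField) (n : ℕ) → 2 ≤ n →
    (m : Game F n) → IsGame F m → Standardized F m → Supermodular F m →
    ((∀ v → IsVertex F m v → ZeroOne F v) ⇔
     (IntegerValued F m × (∀ (i : Fin n) → OrderedField._≤_ F (_-_ F (m ⊤) (m (⊤ ─ ⁅ i ⁆))) (1# F))))
corollary4 F n _ m m⊥≡0 standardized supermodular = mk⇔
  (λ zeroOne → zeroOne-vertices⇒integerValued m⊥≡0 supermodular zeroOne
             , zeroOne-vertices⇒marginal≤1 m⊥≡0 supermodular zeroOne)
  (λ (integerValued , marginal≤1) v →
     vertex-zeroOne m⊥≡0 standardized supermodular integerValued marginal≤1 {v})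
  where
  open MarginalVectors F
  open ZeroOneVertices F
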